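{- For every integer $n\ge 0$ and every integer $k\ge 0$, \[ a_{2,2k+1}(n)=\begin{cases} \ell-k, & \text{if } n=\frac{\ell(\ell+1)}{2} \text{ for some non-negative integer } \ell \text{ and } 0\le k\le \ell-1,\\ 0, & \text{otherwise}.\end{cases} \]
   Context: A partition of $n$ is a non-increasing sequence of positive integers summing to $n$; its Young diagram is the left-justified array of boxes whose $i$-th row has $\lambda_i$ boxes. The hook length of a box is the number of boxes directly to its right in its row, plus the number of boxes directly below it in its column, plus $1$; a box of hook length $k$ is called a $k$-hook. For an integer $t\ge 2$, a $t$-core partition is a partition none of whose hook lengths is divisible by $t$. For $t\ge 2$, $k\ge 1$, $a_{t,k}(n)$ denotes the total number of hooks of length $k$, summed over all $t$-core partitions of $n$. -}

module Defs where

open import Data.Nat using (ℕ; zero; suc; _+_; _∸_; _*_; _≤_; _<_; _≤ᵇ_; _<ᵇ_; _%_; _≡ᵇ_)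
open import Data.Nat.Properties using (_≟_; _≤?_)
open import Data.Bool using (Bool; true; false; if_then_else_; not)
open import Data.List using (List; []; _∷_; map; concat; concatMap; length; upTo; filter; applyUpTo)
open import Data.Bool.ListAction using (all)
open import Relation.Binary.PropositionalEquality using (_≡_)
open import Data.Product using (_×_)
open import Data.Nat.ListAction using (sum)

-- A partition is represented as a List ℕ of its parts (λ₁ ≥ λ₂ ≥ … > 0).
-- All partitions of n whose parts are all ≤ m, listed by largest part first.
-- parts≤ fuel m n : fuel bounds recursion depth (fuel = n suffices).
parts≤ : ℕ → ℕ → ℕ → List (List ℕ)
parts≤ _ m zero = [] ∷ []
parts≤ zero m (suc n) = []
parts≤ (suc f) m (suc n) =
  concatMap (λ p → map (p ∷_) (parts≤ f p (suc n ∸ p)))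
            (applyUpTo suc (Data.Nat._⊓_ m (suc n)))

partitions : ℕ → List (List ℕ)
partitions n = parts≤ n n n

-- conjugate part λ'_j : number of rows of length > j (0-indexed column j)
colLen : List ℕ → ℕ → ℕ
colLen λs j = length (filter (λ r → suc j ≤? r) λs)

-- hook lengths of all boxes, row by row; row i (0-indexed), column j < λᵢ:
-- arm = λᵢ - j - 1, leg = λ'ⱼ - i - 1, hook = arm + leg + 1.
hooksFrom : ℕ → List ℕ → List ℕ → List ℕ
hooksFrom i whole [] = []
hooksFrom i whole (r ∷ rs) =
  map (λ j → (r ∸ suc j) + (colLen whole j ∸ suc i) + 1) (upTo r)
  Data.List.++ hooksFrom (suc i) whole rs

hookLengths : List ℕ → List ℕ
hookLengths λs = hooksFrom 0 λs λs

numHooks : ℕ → List ℕ → ℕ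
numHooks k λs = length (filter (λ h → h ≟ k) (hookLengths λs))

isCore : (t : ℕ) → List ℕ → Bool
isCore t λs = all (λ h → not (h % suc (t ∸ 1) ≡ᵇ 0)) (hookLengths λs)

a : ℕ → ℕ → ℕ → ℕ
a t k n = sum (map (numHooks k) (filter (λ λs → Data.Bool._≟_ (isCore t λs) true) (partitions n)))

-- The hook lengths of a 2-core are all odd. Peeling off the top row shows that the 2-cores are
-- exactly the staircases (ℓ, ℓ-1, …, 1): if the rows below the top one form the staircase of
-- height m, a top row of length m has a box of hook length 0 + 1 + 1, and a top row of length
-- at least m + 2 has a box of hook length 1 + 0 + 1. The staircase of height ℓ has size
-- ℓ(ℓ+1)/2, which determines ℓ, so there is a 2-core of size n only for triangular n, and then
-- exactly one. Its row of length r has hook lengths 2r-1, …, 3, 1, so 2k+1 occurs once in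
-- each of the ℓ-k rows longer than k.
module Submission where

open import Defs
open import Data.Nat using (ℕ; zero; suc; _+_; _*_; _∸_; _<_; _≤_; _≡ᵇ_; _%_; _⊓_; z≤n; s≤s; z<s; s<s; s≤s⁻¹)
open import Data.Nat.Properties
open import Data.Nat.DivMod using ([m+kn]%n≡m%n)
open import Data.Nat.ListAction using (sum)
open import Data.Nat.Tactic.RingSolver using (solve-∀)
open import Data.Bool using (T; not; true)
import Data.Bool as Bool
open import Data.Bool.Properties using (T-≡)
open import Data.List using (List; []; _∷_; _++_; map; concatMap; length; filter; upTo; applyUpTo; applyDownFrom)
open import Data.List.Properties using (filter-++; filter-accept; filter-reject; filter-none; filter-≐; length-++; map-cong; map-cong-local; map-applyUpTo; ++-identityʳ; ∷-injectiveˡ; ∷-injectiveʳ; ≡-dec)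
open import Data.List.Relation.Unary.All as All using (All; []; _∷_)
open import Data.List.Relation.Unary.All.Properties using (all⁺; all⁻; ++⁺; ++⁻ˡ; ++⁻ʳ; map⁺; map⁻; concat⁺; applyUpTo⁺₁; applyUpTo⁺₂; applyUpTo⁻; applyDownFrom⁺₁; applyDownFrom⁺₂; all-filter; filter⁺; all-upTo)
open import Data.Product using (_×_; _,_; ∃-syntax)
open import Data.Empty using (⊥-elim)
open import Function using (_∘_; _⇔_; mk⇔; Equivalence)
open import Relation.Nullary using (¬_; yes; no)
open import Relation.Unary using (Decidable)
open import Relation.Binary.PropositionalEquality using (_≡_; _≢_; refl; sym; trans; cong; cong₂; subst; module ≡-Reasoning)
open import Relation.Binary.Definitions using (DecidableEquality; tri<; tri≈; tri>)

open ≡-Reasoning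

filter-map : ∀ {A B : Set} {P : B → Set} (P? : Decidable P) (f : A → B) xs →
             filter P? (map f xs) ≡ map f (filter (P? ∘ f) xs)
filter-map P? f [] = refl
filter-map P? f (x ∷ xs) with P? (f x)
... | yes _ = cong (f x ∷_) (filter-map P? f xs)
... | no _  = filter-map P? f xs

filter-concatMap : ∀ {A B : Set} {P : B → Set} (P? : Decidable P) (f : A → List B) xs →
                   filter P? (concatMap f xs) ≡ concatMap (filter P? ∘ f) xs
filter-concatMap P? f [] = refl
filter-concatMap P? f (x ∷ xs) =
  trans (filter-++ P? (f x) (concatMap f xs)) (cong (filter P? (f x) ++_) (filter-concatMap P? f xs))

filter-≐-on : ∀ {A : Set} {P Q : A → Set} (P? : Decidable P) (Q? : Decidable Q) {xs} →
              All (λ x → P x ⇔ Q x) xs → filter P? xs ≡ filter Q? xs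
filter-≐-on P? Q? [] = refl
filter-≐-on P? Q? {x ∷ _} (P⇔Q ∷ rest) with P? x
... | yes px = trans (cong (x ∷_) (filter-≐-on P? Q? rest)) (sym (filter-accept Q? (Equivalence.to P⇔Q px)))
... | no ¬px = trans (filter-≐-on P? Q? rest) (sym (filter-reject Q? (¬px ∘ Equivalence.from P⇔Q)))

concatMap-vanishing : ∀ {A B : Set} (g : A → List B) {xs} → All (λ x → g x ≡ []) xs → concatMap g xs ≡ []
concatMap-vanishing g []       = refl
concatMap-vanishing g (e ∷ es) = cong₂ _++_ e (concatMap-vanishing g es)

concatMap-applyUpTo-single : ∀ {A B : Set} (g : A → List B) (f : ℕ → A) {n i} → i < n →
                             (∀ j → j ≢ i → g (f j) ≡ []) → concatMap g (applyUpTo f n) ≡ g (f i)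
concatMap-applyUpTo-single g f {suc n} {zero} z<s vanish =
  trans (cong (g (f 0) ++_) (concatMap-vanishing g (applyUpTo⁺₂ (f ∘ suc) n (λ j → vanish (suc j) λ ()))))
        (++-identityʳ (g (f 0)))
concatMap-applyUpTo-single g f {suc n} {suc i} (s<s i<n) vanish =
  trans (cong (_++ concatMap g (applyUpTo (f ∘ suc) n)) (vanish 0 λ ()))
        (concatMap-applyUpTo-single g (f ∘ suc) i<n (λ j j≢i → vanish (suc j) (j≢i ∘ suc-injective)))

sum-map-≡0 : ∀ {A : Set} (f : A → ℕ) {xs} → All (λ x → f x ≡ 0) xs → sum (map f xs) ≡ 0
sum-map-≡0 f []       = refl
sum-map-≡0 f (e ∷ es) = cong₂ _+_ e (sum-map-≡0 f es)

strictMono⇒injective : ∀ (f : ℕ → ℕ) → (∀ {m n} → m < n → f m < f n) → ∀ {m n} → f m ≡ f n → m ≡ n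
strictMono⇒injective f mono {m} {n} fm≡fn with <-cmp m n
... | tri< m<n _ _ = ⊥-elim (<⇒≢ (mono m<n) fm≡fn)
... | tri≈ _ m≡n _ = m≡n
... | tri> _ _ n<m = ⊥-elim (<⇒≢ (mono n<m) (sym fm≡fn))

triangular-injective : ∀ {ℓ ℓ′} → ℓ * (ℓ + 1) ≡ ℓ′ * (ℓ′ + 1) → ℓ ≡ ℓ′
triangular-injective = strictMono⇒injective (λ ℓ → ℓ * (ℓ + 1)) (λ ℓ<ℓ′ → *-mono-< ℓ<ℓ′ (+-monoˡ-< 1 ℓ<ℓ′))

double+1-injective : ∀ {u v} → u + u + 1 ≡ v + v + 1 → u ≡ v
double+1-injective = strictMono⇒injective (λ v → v + v + 1) (λ u<v → +-monoˡ-< 1 (+-mono-< u<v u<v))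

Odd : ℕ → Set
Odd h = T (not (h % 2 ≡ᵇ 0))

double+1-odd : ∀ v → Odd (v + v + 1)
double+1-odd v = subst Odd (sym (double+1≡1+2v v)) (subst (λ r → T (not (r ≡ᵇ 0))) (sym ([m+kn]%n≡m%n 1 v 2)) _)
  where
  double+1≡1+2v : ∀ v → v + v + 1 ≡ 1 + v * 2
  double+1≡1+2v = solve-∀

-- Every part is bounded by the one before it, so the list is non-increasing.
data Partition≤ (m : ℕ) : List ℕ → Set where
  []   : Partition≤ m []
  part : ∀ {y q} → suc y ≤ m → Partition≤ (suc y) q → Partition≤ m (suc y ∷ q)

Partition≤-mono : ∀ {m m′ P} → m ≤ m′ → Partition≤ m P → Partition≤ m′ P
Partition≤-mono m≤m′ []               = []
Partition≤-mono m≤m′ (part x≤m parts) = part (≤-trans x≤m m≤m′) parts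

Partition≤⇒All≤ : ∀ {m P} → Partition≤ m P → All (_≤ m) P
Partition≤⇒All≤ []               = []
Partition≤⇒All≤ (part x≤m parts) = x≤m ∷ All.map (λ y≤x → ≤-trans y≤x x≤m) (Partition≤⇒All≤ parts)

parts≤-sound : ∀ f m n → All (λ P → Partition≤ m P × sum P ≡ n) (parts≤ f m n)
parts≤-sound f       m zero    = ([] , refl) ∷ []
parts≤-sound zero    m (suc n) = []
parts≤-sound (suc f) m (suc n) =
  concat⁺ (map⁺ (applyUpTo⁺₁ suc (m ⊓ suc n) λ i<K →
    map⁺ (All.map (extend i<K) (parts≤-sound f _ _))))
  where
  extend : ∀ {i q} → suc i ≤ m ⊓ suc n → Partition≤ (suc i) q × sum q ≡ n ∸ i →
           Partition≤ m (suc i ∷ q) × sum (suc i ∷ q) ≡ suc n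
  extend {i} i<K (parts , sum≡) =
    part (≤-trans i<K (m⊓n≤m m (suc n))) parts ,
    cong suc (trans (cong (i +_) sum≡) (m+[n∸m]≡n (s≤s⁻¹ (≤-trans i<K (m⊓n≤n m (suc n))))))

_≟ₗ_ : DecidableEquality (List ℕ)
_≟ₗ_ = ≡-dec _≟_

parts≤-complete : ∀ {f m n P} → Partition≤ m P → sum P ≡ n → n ≤ f →
                  filter (_≟ₗ P) (parts≤ f m n) ≡ P ∷ []
parts≤-complete [] refl _ = refl
parts≤-complete {suc f} {m} {P = suc y ∷ Q} (part x≤m parts) refl (s≤s n≤f) = begin
    filter (_≟ₗ P) (concatMap G (applyUpTo suc K))
  ≡⟨ filter-concatMap (_≟ₗ P) G (applyUpTo suc K) ⟩
    concatMap (filter (_≟ₗ P) ∘ G) (applyUpTo suc K)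
  ≡⟨ concatMap-applyUpTo-single (filter (_≟ₗ P) ∘ G) suc y<K other-heads ⟩
    filter (_≟ₗ P) (map (suc y ∷_) tails)
  ≡⟨ filter-map (_≟ₗ P) (suc y ∷_) tails ⟩
    map (suc y ∷_) (filter ((_≟ₗ P) ∘ (suc y ∷_)) tails)
  ≡⟨ cong (map (suc y ∷_)) (filter-≐ ((_≟ₗ P) ∘ (suc y ∷_)) (_≟ₗ Q) (∷-injectiveʳ , cong (suc y ∷_)) tails) ⟩
    map (suc y ∷_) (filter (_≟ₗ Q) tails)
  ≡⟨ cong (map (suc y ∷_)) (parts≤-complete parts (sym (m+n∸m≡n y (sum Q))) (≤-trans (m∸n≤m _ y) n≤f)) ⟩
    P ∷ []
  ∎
  where
  P = suc y ∷ Q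
  K = m ⊓ suc (y + sum Q)
  G : ℕ → List (List ℕ)
  G p = map (p ∷_) (parts≤ f p (suc (y + sum Q) ∸ p))
  tails : List (List ℕ)
  tails = parts≤ f (suc y) (y + sum Q ∸ y)
  y<K : y < K
  y<K = ⊓-glb x≤m (s≤s (m≤m+n y (sum Q)))
  other-heads : ∀ j → j ≢ y → filter (_≟ₗ P) (G (suc j)) ≡ []
  other-heads j j≢y =
    filter-none (_≟ₗ P) (map⁺ (All.universal (λ _ → j≢y ∘ suc-injective ∘ ∷-injectiveˡ) (parts≤ f (suc j) (y + sum Q ∸ j))))

topRowHooks : ℕ → List ℕ → List ℕ
topRowHooks x Q = map (λ j → (x ∸ suc j) + colLen Q j + 1) (upTo x)

colLen-∷ : ∀ {j x} Q → j < x → colLen (x ∷ Q) j ≡ suc (colLen Q j)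
colLen-∷ {j} {x} Q j<x = cong length (filter-accept (λ r → suc j ≤? r) {x} {Q} j<x)

-- A new top row shifts every row index by one and lengthens the columns below it by one;
-- the two cancel in the leg lengths.
hooksFrom-∷ : ∀ i x Q R → All (_≤ x) R → hooksFrom (suc i) (x ∷ Q) R ≡ hooksFrom i Q R
hooksFrom-∷ i x Q []      []           = refl
hooksFrom-∷ i x Q (r ∷ R) (r≤x ∷ R≤x) =
  cong₂ _++_ (map-cong-local (All.map (λ j<r → cong (λ c → (r ∸ suc _) + (c ∸ suc (suc i)) + 1) (colLen-∷ Q (≤-trans j<r r≤x))) (all-upTo r)))
             (hooksFrom-∷ (suc i) x Q R R≤x)

hookLengths-∷ : ∀ x Q → All (_≤ x) Q → hookLengths (x ∷ Q) ≡ topRowHooks x Q ++ hookLengths Q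
hookLengths-∷ x Q Q≤x =
  cong₂ _++_ (map-cong-local (All.map (λ j<x → cong (λ c → (x ∸ suc _) + (c ∸ 1) + 1) (colLen-∷ Q j<x)) (all-upTo x)))
             (hooksFrom-∷ 0 x Q Q Q≤x)

staircase : ℕ → List ℕ
staircase zero    = []
staircase (suc ℓ) = suc ℓ ∷ staircase ℓ

staircase-partition : ∀ ℓ → Partition≤ ℓ (staircase ℓ)
staircase-partition zero    = []
staircase-partition (suc ℓ) = part ≤-refl (Partition≤-mono (n≤1+n ℓ) (staircase-partition ℓ))

staircase-head≤ : ∀ {m x} → All (_≤ x) (staircase m) → m ≤ x
staircase-head≤ {zero}  _           = z≤n
staircase-head≤ {suc m} (1+m≤x ∷ _) = 1+m≤x

≤-sum-staircase : ∀ ℓ → ℓ ≤ sum (staircase ℓ)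
≤-sum-staircase zero    = z≤n
≤-sum-staircase (suc ℓ) = m≤m+n (suc ℓ) (sum (staircase ℓ))

double-sum-staircase : ∀ ℓ → 2 * sum (staircase ℓ) ≡ ℓ * (ℓ + 1)
double-sum-staircase zero    = refl
double-sum-staircase (suc ℓ) = begin
  2 * (suc ℓ + sum (staircase ℓ))    ≡⟨ *-distribˡ-+ 2 (suc ℓ) (sum (staircase ℓ)) ⟩
  2 * suc ℓ + 2 * sum (staircase ℓ)  ≡⟨ cong (2 * suc ℓ +_) (double-sum-staircase ℓ) ⟩
  2 * suc ℓ + ℓ * (ℓ + 1)            ≡⟨ triangular-step ℓ ⟩
  suc ℓ * (suc ℓ + 1)                ∎
  where
  triangular-step : ∀ ℓ → 2 * suc ℓ + ℓ * (ℓ + 1) ≡ suc ℓ * (suc ℓ + 1)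
  triangular-step = solve-∀

colLen-staircase : ∀ m j → colLen (staircase m) j ≡ m ∸ j
colLen-staircase zero    j = sym (0∸n≡0 j)
colLen-staircase (suc m) j with j ≤? m
... | yes j≤m = begin
  colLen (staircase (suc m)) j  ≡⟨ colLen-∷ (staircase m) (s≤s j≤m) ⟩
  suc (colLen (staircase m) j)  ≡⟨ cong suc (colLen-staircase m j) ⟩
  suc (m ∸ j)                   ≡⟨ +-∸-assoc 1 j≤m ⟨
  suc m ∸ j                     ∎
... | no j≰m = begin
  colLen (staircase (suc m)) j  ≡⟨ cong length (filter-reject (λ r → suc j ≤? r) (j≰m ∘ s≤s⁻¹)) ⟩
  colLen (staircase m) j        ≡⟨ colLen-staircase m j ⟩
  m ∸ j                         ≡⟨ m≤n⇒m∸n≡0 (<⇒≤ m<j) ⟩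
  0                             ≡⟨ m≤n⇒m∸n≡0 m<j ⟨
  suc m ∸ j                     ∎
  where
  m<j : m < j
  m<j = ≰⇒> j≰m

oddsBelow : ℕ → List ℕ
oddsBelow = applyDownFrom (λ v → v + v + 1)

applyUpTo-∸ : ∀ {A : Set} (h : ℕ → A) m → applyUpTo (λ j → h (m ∸ j)) (suc m) ≡ applyDownFrom h (suc m)
applyUpTo-∸ h zero    = refl
applyUpTo-∸ h (suc m) = cong (h (suc m) ∷_) (applyUpTo-∸ h m)

hookLengths-staircase : ∀ m → hookLengths (staircase (suc m)) ≡ oddsBelow (suc m) ++ hookLengths (staircase m)
hookLengths-staircase m = begin
  hookLengths (staircase (suc m))
    ≡⟨ hookLengths-∷ (suc m) (staircase m) (Partition≤⇒All≤ (Partition≤-mono (n≤1+n m) (staircase-partition m))) ⟩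
  topRowHooks (suc m) (staircase m) ++ hookLengths (staircase m)
    ≡⟨ cong (_++ hookLengths (staircase m)) top-row ⟩
  oddsBelow (suc m) ++ hookLengths (staircase m) ∎
  where
  top-row : topRowHooks (suc m) (staircase m) ≡ oddsBelow (suc m)
  top-row = begin
    map (λ j → (m ∸ j) + colLen (staircase m) j + 1) (upTo (suc m))
      ≡⟨ map-cong (λ j → cong (λ c → (m ∸ j) + c + 1) (colLen-staircase m j)) (upTo (suc m)) ⟩
    map (λ j → (m ∸ j) + (m ∸ j) + 1) (upTo (suc m))
      ≡⟨ map-applyUpTo (λ j → j) (λ j → (m ∸ j) + (m ∸ j) + 1) (suc m) ⟩
    applyUpTo (λ j → (m ∸ j) + (m ∸ j) + 1) (suc m)
      ≡⟨ applyUpTo-∸ (λ v → v + v + 1) m ⟩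
    oddsBelow (suc m) ∎

staircase-odd : ∀ ℓ → All Odd (hookLengths (staircase ℓ))
staircase-odd zero    = []
staircase-odd (suc ℓ) =
  subst (All Odd) (sym (hookLengths-staircase ℓ)) (++⁺ (applyDownFrom⁺₂ _ (suc ℓ) double+1-odd) (staircase-odd ℓ))

count : ℕ → List ℕ → ℕ
count h hs = length (filter (_≟ h) hs)

count-++ : ∀ h xs ys → count h (xs ++ ys) ≡ count h xs + count h ys
count-++ h xs ys = trans (cong length (filter-++ (_≟ h) xs ys)) (length-++ (filter (_≟ h) xs))

count-oddsBelow-≤ : ∀ {k n} → n ≤ k → count (k + k + 1) (oddsBelow n) ≡ 0
count-oddsBelow-≤ {k} {n} n≤k =
  cong length (filter-none (_≟ k + k + 1) (applyDownFrom⁺₁ _ n (λ v<n → <⇒≢ (<-≤-trans v<n n≤k) ∘ double+1-injective)))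

count-oddsBelow-> : ∀ {k} n → k < n → count (k + k + 1) (oddsBelow n) ≡ 1
count-oddsBelow-> {k} (suc n) k<1+n with n ≟ k
... | yes refl = trans (cong length (filter-accept (_≟ k + k + 1) refl)) (cong suc (count-oddsBelow-≤ {k} ≤-refl))
... | no n≢k   = trans (cong length (filter-reject (_≟ k + k + 1) (n≢k ∘ double+1-injective)))
                       (count-oddsBelow-> n (≤∧≢⇒< (s≤s⁻¹ k<1+n) (n≢k ∘ sym)))

count-staircase : ∀ k ℓ → count (k + k + 1) (hookLengths (staircase ℓ)) ≡ ℓ ∸ k
count-staircase k zero    = sym (0∸n≡0 k)
count-staircase k (suc ℓ) = begin
  count h (hookLengths (staircase (suc ℓ)))
    ≡⟨ cong (count h) (hookLengths-staircase ℓ) ⟩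
  count h (oddsBelow (suc ℓ) ++ hookLengths (staircase ℓ))
    ≡⟨ count-++ h (oddsBelow (suc ℓ)) (hookLengths (staircase ℓ)) ⟩
  count h (oddsBelow (suc ℓ)) + count h (hookLengths (staircase ℓ))
    ≡⟨ cong (count h (oddsBelow (suc ℓ)) +_) (count-staircase k ℓ) ⟩
  count h (oddsBelow (suc ℓ)) + (ℓ ∸ k)
    ≡⟨ top-row ⟩
  suc ℓ ∸ k ∎
  where
  h = k + k + 1
  top-row : count h (oddsBelow (suc ℓ)) + (ℓ ∸ k) ≡ suc ℓ ∸ k
  top-row with k ≤? ℓ
  ... | yes k≤ℓ = trans (cong (_+ (ℓ ∸ k)) (count-oddsBelow-> (suc ℓ) (s≤s k≤ℓ))) (sym (+-∸-assoc 1 k≤ℓ))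
  ... | no k≰ℓ  = trans (cong₂ _+_ (count-oddsBelow-≤ (≰⇒> k≰ℓ)) (m≤n⇒m∸n≡0 (<⇒≤ (≰⇒> k≰ℓ))))
                        (sym (m≤n⇒m∸n≡0 (≰⇒> k≰ℓ)))

numHooks-staircase : ∀ k ℓ → numHooks (2 * k + 1) (staircase ℓ) ≡ ℓ ∸ k
numHooks-staircase k ℓ =
  -- 2 * k unfolds to k + (k + 0)
  trans (cong (λ t → count (k + t + 1) (hookLengths (staircase ℓ))) (+-identityʳ k)) (count-staircase k ℓ)

isCore2⇔odd : ∀ P → isCore 2 P ≡ true ⇔ All Odd (hookLengths P)
isCore2⇔odd P = mk⇔ (all⁺ _ (hookLengths P) ∘ Equivalence.from T-≡) (Equivalence.to T-≡ ∘ all⁻ _)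

two-hook : ∀ {y m} → m ≤ suc y → y ≢ m → ∃[ j ] j < suc y × (y ∸ j) + (m ∸ j) + 1 ≡ 2
two-hook {y} {m} m≤1+y y≢m with <-cmp y m
... | tri< y<m _ _ rewrite ≤-antisym m≤1+y y<m =
  y , ≤-refl , cong₂ (λ a b → a + b + 1) (n∸n≡0 y) (m+n∸n≡m 1 y)
... | tri≈ _ y≡m _ = ⊥-elim (y≢m y≡m)
... | tri> _ _ (s≤s {n = z} m≤z) =
  z , n≤1+n (suc z) , cong₂ (λ a b → a + b + 1) (m+n∸n≡m 1 z) (m≤n⇒m∸n≡0 m≤z)

odd-top-row-over-staircase : ∀ {y m} → m ≤ suc y → All Odd (topRowHooks (suc y) (staircase m)) → y ≡ m
odd-top-row-over-staircase {y} {m} m≤1+y odd with y ≟ m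
... | yes y≡m = y≡m
... | no y≢m with two-hook m≤1+y y≢m
...   | j , j<1+y , hook≡2 = ⊥-elim (subst Odd hook≡2 (subst (λ c → Odd ((y ∸ j) + c + 1)) (colLen-staircase m j) odd-at-j))
  where
  odd-at-j : Odd ((y ∸ j) + colLen (staircase m) j + 1)
  odd-at-j = applyUpTo⁻ (λ i → i) (suc y) (map⁻ odd) j<1+y

odd-hooks⇒staircase : ∀ {m P} → Partition≤ m P → All Odd (hookLengths P) → P ≡ staircase (length P)
odd-hooks⇒staircase []                     _   = refl
odd-hooks⇒staircase (part {y} {Q} _ parts) odd = cong₂ _∷_ (cong suc y≡) Q≡
  where
  Q≤ : All (_≤ suc y) Q
  Q≤ = Partition≤⇒All≤ parts
  split : All Odd (topRowHooks (suc y) Q ++ hookLengths Q)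
  split = subst (All Odd) (hookLengths-∷ (suc y) Q Q≤) odd
  Q≡ : Q ≡ staircase (length Q)
  Q≡ = odd-hooks⇒staircase parts (++⁻ʳ (topRowHooks (suc y) Q) split)
  y≡ : y ≡ length Q
  y≡ = odd-top-row-over-staircase (staircase-head≤ (subst (All (_≤ suc y)) Q≡ Q≤))
         (subst (λ R → All Odd (topRowHooks (suc y) R)) Q≡ (++⁻ˡ (topRowHooks (suc y) Q) split))

twoCore-shape : ∀ {m n P} → Partition≤ m P × sum P ≡ n → isCore 2 P ≡ true →
                P ≡ staircase (length P) × 2 * n ≡ length P * (length P + 1)
twoCore-shape {n = n} {P} (parts , sum≡n) core = P≡ , (begin
  2 * n                          ≡⟨ cong (2 *_) sum≡n ⟨
  2 * sum P                      ≡⟨ cong (λ R → 2 * sum R) P≡ ⟩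
  2 * sum (staircase (length P)) ≡⟨ double-sum-staircase (length P) ⟩
  length P * (length P + 1)      ∎)
  where
  P≡ : P ≡ staircase (length P)
  P≡ = odd-hooks⇒staircase parts (Equivalence.to (isCore2⇔odd P) core)

twoCore⇔staircase : ∀ {m n ℓ P} → 2 * n ≡ ℓ * (ℓ + 1) → Partition≤ m P × sum P ≡ n →
                    isCore 2 P ≡ true ⇔ P ≡ staircase ℓ
twoCore⇔staircase {ℓ = ℓ} {P} 2n≡ partition = mk⇔ to from
  where
  to : isCore 2 P ≡ true → P ≡ staircase ℓ
  to core with twoCore-shape partition core
  ... | P≡ , 2n≡′ = trans P≡ (cong staircase (triangular-injective (trans (sym 2n≡′) 2n≡)))
  from : P ≡ staircase ℓ → isCore 2 P ≡ true
  from refl = Equivalence.from (isCore2⇔odd (staircase ℓ)) (staircase-odd ℓ)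

numHooks-twoCore : ∀ {m n P} k → Partition≤ m P × sum P ≡ n → isCore 2 P ≡ true →
                   ∃[ ℓ ] 2 * n ≡ ℓ * (ℓ + 1) × numHooks (2 * k + 1) P ≡ ℓ ∸ k
numHooks-twoCore {P = P} k partition core with twoCore-shape partition core
... | P≡ , 2n≡ = length P , 2n≡ , trans (cong (numHooks (2 * k + 1)) P≡) (numHooks-staircase k (length P))

isCore2? : Decidable (λ P → isCore 2 P ≡ true)
isCore2? P = isCore 2 P Bool.≟ true

twoCores-triangular : ∀ n ℓ → 2 * n ≡ ℓ * (ℓ + 1) → filter isCore2? (partitions n) ≡ staircase ℓ ∷ []
twoCores-triangular n ℓ 2n≡ = begin
  filter isCore2? (partitions n)
    ≡⟨ filter-≐-on isCore2? (_≟ₗ staircase ℓ) (All.map (twoCore⇔staircase 2n≡) (parts≤-sound n n n)) ⟩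
  filter (_≟ₗ staircase ℓ) (partitions n)
    ≡⟨ parts≤-complete (Partition≤-mono ℓ≤n (staircase-partition ℓ)) sum≡n ≤-refl ⟩
  staircase ℓ ∷ [] ∎
  where
  sum≡n : sum (staircase ℓ) ≡ n
  sum≡n = *-cancelˡ-≡ _ _ 2 (trans (double-sum-staircase ℓ) (sym 2n≡))
  ℓ≤n : ℓ ≤ n
  ℓ≤n = subst (ℓ ≤_) sum≡n (≤-sum-staircase ℓ)

proposition1p1 : (n k : ℕ) →
    ((ℓ : ℕ) → 2 * n ≡ ℓ * (ℓ + 1) → k < ℓ → a 2 (2 * k + 1) n ≡ ℓ ∸ k)
    × (¬ (∃[ ℓ ] (2 * n ≡ ℓ * (ℓ + 1) × k < ℓ)) → a 2 (2 * k + 1) n ≡ 0)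
proposition1p1 n k = triangular , non-triangular
  where
  triangular : ∀ ℓ → 2 * n ≡ ℓ * (ℓ + 1) → k < ℓ → a 2 (2 * k + 1) n ≡ ℓ ∸ k
  triangular ℓ 2n≡ _ = begin
    sum (map (numHooks (2 * k + 1)) (filter isCore2? (partitions n)))
      ≡⟨ cong (sum ∘ map (numHooks (2 * k + 1))) (twoCores-triangular n ℓ 2n≡) ⟩
    numHooks (2 * k + 1) (staircase ℓ) + 0
      ≡⟨ +-identityʳ _ ⟩
    numHooks (2 * k + 1) (staircase ℓ)
      ≡⟨ numHooks-staircase k ℓ ⟩
    ℓ ∸ k ∎
  non-triangular : ¬ (∃[ ℓ ] (2 * n ≡ ℓ * (ℓ + 1) × k < ℓ)) → a 2 (2 * k + 1) n ≡ 0
  non-triangular no-ℓ = sum-map-≡0 (numHooks (2 * k + 1))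
    (All.zipWith no-hooks (filter⁺ isCore2? (parts≤-sound n n n) , all-filter isCore2? (partitions n)))
    where
    no-hooks : ∀ {P} → (Partition≤ n P × sum P ≡ n) × isCore 2 P ≡ true → numHooks (2 * k + 1) P ≡ 0
    no-hooks (partition , core) with numHooks-twoCore k partition core
    ... | ℓ , 2n≡ , hooks≡ = trans hooks≡ (m≤n⇒m∸n≡0 (≮⇒≥ (λ k<ℓ → no-ℓ (ℓ , 2n≡ , k<ℓ))))
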